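{- Let $G$ be a connected finite simple graph with chromatic number $\chi(G)$ and independence number $\alpha(G)$. Then $$\chi_{md}(G)\leq \chi(G)+\left\lceil \frac{\alpha(G)}{2}\right\rceil-1.$$ Moreover, the bound is sharp: there exist connected graphs for which equality holds.
   Context: All graphs are finite and simple. For a vertex $v$, $N[v]=N(v)\cup\{v\}$ is its closed neighborhood; $v$ dominates exactly the vertices of $N[v]$. A majority dominator coloring of $G$ is a proper vertex coloring of $G$ such that for every vertex $v$ there is a color class $C$ with $|N[v]\cap C|\geq |C|/2$ (i.e. $v$ dominates at least half of some color class; this may be its own class, which then has at most two vertices). The majority dominator chromatic number $\chi_{md}(G)$ is the minimum number of color classes in a majority dominator coloring of $G$. $\alpha(G)$ is the maximum size of an independent set. -}

module Defs where

open import Data.Nat using (ℕ; suc; _≤_; _*_)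
open import Data.Fin using (Fin)
open import Data.Fin.Properties using (_≟_)
open import Data.Bool using (Bool; T; true; false)
open import Data.Bool.Properties using (T?)
open import Data.List using (List; length; filter; allFin)
open import Data.List.Relation.Unary.All using (All)
open import Data.List.Relation.Unary.Unique.Propositional using (Unique)
open import Data.List.Membership.Propositional using (_∈_)
open import Data.Product using (Σ; ∃; _×_)
open import Data.Sum using (_⊎_)
open import Relation.Nullary using (¬_)
open import Relation.Nullary.Decidable using (_⊎-dec_; _×-dec_)
open import Relation.Binary.PropositionalEquality using (_≡_; _≢_)

record Graph (n : ℕ) : Set where
  field
    adj   : Fin n → Fin n → Bool
    sym   : ∀ u v → adj u v ≡ adj v u
    irref : ∀ v → adj v v ≡ false

module _ {n : ℕ} (G : Graph n) where
  open Graph G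

  Adj : Fin n → Fin n → Set
  Adj u v = T (adj u v)

  data Reach : Fin n → Fin n → Set where
    here : ∀ {v} → Reach v v
    step : ∀ {u w v} → Adj u w → Reach w v → Reach u v

  Connected : Set
  Connected = ∀ u v → Reach u v

  -- proper colouring with colours Fin k (not all colours need be used)
  Proper : {k : ℕ} → (Fin n → Fin k) → Set
  Proper c = ∀ u v → Adj u v → c u ≢ c v

  Independent : List (Fin n) → Set
  Independent S = Unique S × (∀ {u v} → u ∈ S → v ∈ S → ¬ Adj u v)

  IsIndependenceNumber : ℕ → Set
  IsIndependenceNumber a =
    Σ (List (Fin n)) (λ S → Independent S × length S ≡ a)
    × (∀ S → Independent S → length S ≤ a)

  IsChromaticNumber : ℕ → Set
  IsChromaticNumber χ =
    Σ (Fin n → Fin χ) Proper × (∀ k (c : Fin n → Fin k) → Proper c → χ ≤ k)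

  classSize : {k : ℕ} → (Fin n → Fin k) → Fin k → ℕ
  classSize c j = length (filter (λ u → c u ≟ j) (allFin n))

  closedNbhdInClass : {k : ℕ} → (Fin n → Fin k) → Fin n → Fin k → ℕ
  closedNbhdInClass c v j =
    length (filter (λ u → ((u ≟ v) ⊎-dec T? (adj v u)) ×-dec (c u ≟ j)) (allFin n))

  IsMDColoring : {k : ℕ} → (Fin n → Fin k) → Set
  IsMDColoring {k} c =
    Proper c
    × (∀ (j : Fin k) → ∃ λ u → c u ≡ j)
    × (∀ v → ∃ λ (j : Fin k) → classSize c j ≤ 2 * closedNbhdInClass c v j)

  IsMDChromaticNumber : ℕ → Set
  IsMDChromaticNumber m =
    Σ (Fin n → Fin m) IsMDColoring
    × (∀ k (c : Fin n → Fin k) → IsMDColoring c → m ≤ k)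

-- Take a χ-colouring c and extend its colour class 0 to a maximal independent
-- set S; S is dominating and has at most α vertices. Keep the remaining χ − 1
-- colours of c outside S and split S into ⌈α/2⌉ classes of at most two
-- vertices, pairing consecutive entries of a list of S. Every vertex lies in
-- or next to some s ∈ S, and it then dominates at least one of the at most two
-- vertices coloured like s. Discarding unused colours gives a majority dominator
-- colouring with at most χ − 1 + ⌈α/2⌉ colours. Equality holds for K₁.
module Submission where

open import Defs
open import Data.Nat using (ℕ; suc; _+_; _≤_; ⌈_/2⌉)
open import Data.Product using (Σ; ∃; _×_)
open import Relation.Binary.PropositionalEquality using (_≡_)

open import Data.Nat using (zero; ⌊_/2⌋; parity; z≤n; s≤s; _*_)
open import Data.Nat.Properties using (≤-trans; ≤-refl; m≤n⇒m≤1+n; +-suc; +-identityʳ; +-comm; m≤n+m; ⌈n/2⌉-mono; *-monoʳ-≤; suc-injective; n≮n)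
open import Data.Parity.Base using (Parity; 0ℙ; 1ℙ)
open import Data.Fin as Fin using (Fin; toℕ; fromℕ<; punchOut; join; splitAt)
open import Data.Fin.Properties using (all?; any?; ¬∀⟶∃¬; punchOut-injective; splitAt-join; toℕ-fromℕ<; toℕ-injective; toℕ<n) renaming (_≟_ to _≟ᶠ_)
open import Data.Bool using (T; false)
open import Data.Bool.Properties using (T?)
open import Data.List using (List; []; _∷_; length; filter; allFin; lookup)
open import Data.List.Relation.Unary.Any as Any using (Any; here; there; index)
open import Data.List.Relation.Unary.Any.Properties using (lookup-index)
open import Data.List.Relation.Unary.All as All using ()
open import Data.List.Relation.Unary.All.Properties using (¬Any⇒All¬)
open import Data.List.Relation.Unary.AllPairs using ([]; _∷_)
open import Data.List.Relation.Unary.Unique.Propositional using (Unique)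
open import Data.List.Relation.Unary.Unique.Propositional.Properties using (allFin⁺; filter⁺)
open import Data.List.Relation.Binary.Subset.Propositional using (_⊆_)
open import Data.List.Membership.Propositional using (_∈_; _∉_; lose; find)
open import Data.List.Membership.Propositional.Properties using (∈-filter⁺; ∈-filter⁻; ∈-allFin; ∈-length)
import Data.List.Membership.DecPropositional as DecMembership
open import Data.Product using (_,_; proj₁; proj₂)
open import Data.Sum using (_⊎_; inj₁; inj₂)
open import Data.Sum.Properties using (inj₁-injective)
open import Data.Empty using (⊥-elim)
open import Relation.Nullary using (¬_; Dec; yes; no)
open import Relation.Nullary.Decidable using (_⊎-dec_; _×-dec_)
open import Relation.Binary.PropositionalEquality using (refl; sym; trans; cong; subst; _≢_; module ≡-Reasoning)

unique-length≤2 : ∀ {A : Set} (xs : List A) → Unique xs →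
  (∀ {x y z} → x ∈ xs → y ∈ xs → z ∈ xs → x ≡ y ⊎ x ≡ z ⊎ y ≡ z) → length xs ≤ 2
unique-length≤2 [] _ _ = z≤n
unique-length≤2 (_ ∷ []) _ _ = s≤s z≤n
unique-length≤2 (_ ∷ _ ∷ []) _ _ = s≤s (s≤s z≤n)
unique-length≤2 (_ ∷ _ ∷ _ ∷ _) ((x≢y All.∷ x≢z All.∷ _) ∷ (y≢z All.∷ _) ∷ _) two-equal
  with two-equal (here refl) (there (here refl)) (there (there (here refl)))
... | inj₁ x≡y = ⊥-elim (x≢y x≡y)
... | inj₂ (inj₁ x≡z) = ⊥-elim (x≢z x≡z)
... | inj₂ (inj₂ y≡z) = ⊥-elim (y≢z y≡z)

parity-pigeonhole : (p q r : Parity) → p ≡ q ⊎ p ≡ r ⊎ q ≡ r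
parity-pigeonhole 0ℙ 0ℙ _  = inj₁ refl
parity-pigeonhole 1ℙ 1ℙ _  = inj₁ refl
parity-pigeonhole 0ℙ 1ℙ 0ℙ = inj₂ (inj₁ refl)
parity-pigeonhole 0ℙ 1ℙ 1ℙ = inj₂ (inj₂ refl)
parity-pigeonhole 1ℙ 0ℙ 0ℙ = inj₂ (inj₂ refl)
parity-pigeonhole 1ℙ 0ℙ 1ℙ = inj₂ (inj₁ refl)

⌊/2⌋-parity-injective : ∀ i j → ⌊ i /2⌋ ≡ ⌊ j /2⌋ → parity i ≡ parity j → i ≡ j
⌊/2⌋-parity-injective zero          zero          _ _ = refl
⌊/2⌋-parity-injective zero          (suc zero)    _ ()
⌊/2⌋-parity-injective zero          (suc (suc j)) () _
⌊/2⌋-parity-injective (suc zero)    zero          _ ()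
⌊/2⌋-parity-injective (suc zero)    (suc zero)    _ _ = refl
⌊/2⌋-parity-injective (suc zero)    (suc (suc j)) () _
⌊/2⌋-parity-injective (suc (suc i)) zero          () _
⌊/2⌋-parity-injective (suc (suc i)) (suc zero)    () _
⌊/2⌋-parity-injective (suc (suc i)) (suc (suc j)) h≡ p≡ =
  cong (λ k → suc (suc k)) (⌊/2⌋-parity-injective i j (suc-injective h≡) p≡)

AllColoursUsed : ∀ {N k} → (Fin N → Fin k) → Set
AllColoursUsed {N} {k} g = ∀ (j : Fin k) → ∃ λ (u : Fin N) → g u ≡ j

dropUnusedColours : ∀ {N} K (f : Fin N → Fin K) →
  ∃ λ k → k ≤ K × Σ (Fin N → Fin k) λ g →
    AllColoursUsed g × (∀ u v → g u ≡ g v → f u ≡ f v)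
dropUnusedColours K f with all? (λ j → any? (λ u → f u ≟ᶠ j))
... | yes used = K , ≤-refl , f , used , λ _ _ e → e
dropUnusedColours zero f | no unused = ⊥-elim (unused λ ())
dropUnusedColours (suc K) f | no unused
  with ¬∀⟶∃¬ (suc K) _ (λ j → any? (λ u → f u ≟ᶠ j)) unused
... | j , j-unused
  with dropUnusedColours K (λ u → punchOut {i = j} (λ e → j-unused (u , sym e)))
... | k , k≤K , g , g-onto , g-ker =
  k , m≤n⇒m≤1+n k≤K , g , g-onto ,
  λ u v e → punchOut-injective (λ e′ → j-unused (u , sym e′)) (λ e′ → j-unused (v , sym e′)) (g-ker u v e)

module _ {n : ℕ} (G : Graph n) where
  open Graph G using (adj; irref)

  Adj-sym : ∀ {u v} → Adj G u v → Adj G v u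
  Adj-sym {u} {v} = subst T (Graph.sym G u v)

  Adj-irrefl : ∀ {v} → ¬ Adj G v v
  Adj-irrefl {v} = subst T (irref v)

  _∈N[_] : Fin n → Fin n → Set
  s ∈N[ v ] = s ≡ v ⊎ Adj G v s

  _∈N[_]? : ∀ s v → Dec (s ∈N[ v ])
  s ∈N[ v ]? = (s ≟ᶠ v) ⊎-dec T? (adj v s)

  Dominating : List (Fin n) → Set
  Dominating S = ∀ v → Any (_∈N[ v ]) S

  independent-∷ : ∀ {S w} → Independent G S → w ∉ S → ¬ Any (Adj G w) S →
    Independent G (w ∷ S)
  independent-∷ {S} {w} (unique , indep) w∉S no-nbr = ¬Any⇒All¬ S w∉S ∷ unique , indep′
    where
    indep′ : ∀ {x y} → x ∈ w ∷ S → y ∈ w ∷ S → ¬ Adj G x y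
    indep′ (here refl) (here refl) = Adj-irrefl
    indep′ (here refl) (there y∈S) w~y = no-nbr (lose y∈S w~y)
    indep′ (there x∈S) (here refl) x~w = no-nbr (lose x∈S (Adj-sym x~w))
    indep′ (there x∈S) (there y∈S) = indep x∈S y∈S

  -- An undominated vertex can be added to S; the fuel d bounds how often this happens.
  extendToDominating : ∀ {a} → (∀ S → Independent G S → length S ≤ a) →
    ∀ d S → Independent G S → a ≤ length S + d →
    ∃ λ S′ → Independent G S′ × Dominating S′ × S ⊆ S′
  extendToDominating {a} bound d S indep a≤ with all? (λ v → Any.any? (_∈N[ v ]?) S)
  ... | yes dom = S , indep , dom , λ x∈S → x∈S
  ... | no ¬dom with ¬∀⟶∃¬ n _ (λ v → Any.any? (_∈N[ v ]?) S) ¬dom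
  ... | w , w-undominated with
        independent-∷ indep (λ w∈S → w-undominated (lose w∈S (inj₁ refl)))
                            (λ w~S → w-undominated (Any.map inj₂ w~S))
  ... | indep′ with d
  ...   | zero = ⊥-elim (n≮n (length S)
                   (≤-trans (bound (w ∷ S) indep′) (subst (a ≤_) (+-identityʳ (length S)) a≤)))
  ...   | suc d = let S′ , indep″ , dom , w∷S⊆S′ = extendToDominating bound d (w ∷ S) indep′
                                                    (subst (a ≤_) (+-suc (length S) d) a≤)
                  in S′ , indep″ , dom , λ x∈S → w∷S⊆S′ (there x∈S)

  colourClass : ∀ {k} → (Fin n → Fin k) → Fin k → List (Fin n)
  colourClass c j = filter (λ u → c u ≟ᶠ j) (allFin n)

  ∈-colourClass⁺ : ∀ {k} (c : Fin n → Fin k) {j x} → c x ≡ j → x ∈ colourClass c j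
  ∈-colourClass⁺ c {j} {x} = ∈-filter⁺ (λ u → c u ≟ᶠ j) (∈-allFin x)

  ∈-colourClass⁻ : ∀ {k} (c : Fin n → Fin k) {j x} → x ∈ colourClass c j → c x ≡ j
  ∈-colourClass⁻ c {j} x∈ = proj₂ (∈-filter⁻ (λ u → c u ≟ᶠ j) {xs = allFin n} x∈)

  colourClass-unique : ∀ {k} (c : Fin n → Fin k) j → Unique (colourClass c j)
  colourClass-unique c j = filter⁺ (λ u → c u ≟ᶠ j) (allFin⁺ n)

  colourClass-independent : ∀ {k} {c : Fin n → Fin k} → Proper G c → ∀ j →
    Independent G (colourClass c j)
  colourClass-independent {c = c} proper j = colourClass-unique c j ,
    λ x∈ y∈ x~y → proper _ _ x~y (trans (∈-colourClass⁻ c x∈) (sym (∈-colourClass⁻ c y∈)))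

  classSize≤2 : ∀ {k} (c : Fin n → Fin k) j →
    (∀ {x y z} → c x ≡ j → c y ≡ j → c z ≡ j → x ≡ y ⊎ x ≡ z ⊎ y ≡ z) →
    classSize G c j ≤ 2
  classSize≤2 c j two-equal = unique-length≤2 _ (colourClass-unique c j)
    λ x∈ y∈ z∈ → two-equal (∈-colourClass⁻ c x∈) (∈-colourClass⁻ c y∈) (∈-colourClass⁻ c z∈)

  closedNbhdInClass-pos : ∀ {k} (c : Fin n → Fin k) {v s} → s ∈N[ v ] →
    1 ≤ closedNbhdInClass G c v (c s)
  closedNbhdInClass-pos c {v} {s} s∈N[v] =
    ∈-length (∈-filter⁺ (λ u → (u ∈N[ v ]?) ×-dec (c u ≟ᶠ c s))
                        (∈-allFin s) (s∈N[v] , refl))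

  -- Dominating one vertex of a class with at most two vertices is dominating half of it.
  isMDColoring-fromSmallClasses : ∀ {k} (g : Fin n → Fin k) S → Proper G g → AllColoursUsed g →
    Dominating S → (∀ {s} → s ∈ S → classSize G g (g s) ≤ 2) → IsMDColoring G g
  isMDColoring-fromSmallClasses g S proper onto dom small = proper , onto , majority
    where
    majority : ∀ v → ∃ λ j → classSize G g j ≤ 2 * closedNbhdInClass G g v j
    majority v = let s , s∈S , s∈N[v] = find (dom v)
                 in g s , ≤-trans (small s∈S) (*-monoʳ-≤ 2 (closedNbhdInClass-pos g s∈N[v]))

module PairColouring {n} (G : Graph n) {χ′ a : ℕ} {c : Fin n → Fin (suc χ′)} (proper : Proper G c)
  {S : List (Fin n)} (indep : Independent G S) (dom : Dominating G S) (|S|≤a : length S ≤ a)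
  (class₀⊆S : colourClass G c Fin.zero ⊆ S) where
  open DecMembership (_≟ᶠ_ {n}) using (_∈?_)

  -- The i-th entry of S gets pair colour ⌊ i /2⌋.
  pairColour : ∀ {u} → u ∈ S → Fin ⌈ a /2⌉
  pairColour u∈S = fromℕ< (⌈n/2⌉-mono (≤-trans (toℕ<n (index u∈S)) |S|≤a))

  pairColour-parity-injective : ∀ {x y} (x∈S : x ∈ S) (y∈S : y ∈ S) → pairColour x∈S ≡ pairColour y∈S →
    parity (toℕ (index x∈S)) ≡ parity (toℕ (index y∈S)) → x ≡ y
  pairColour-parity-injective x∈S y∈S same-pair same-parity = begin
    _                       ≡⟨ lookup-index x∈S ⟩
    lookup S (index x∈S)    ≡⟨ cong (lookup S) (toℕ-injective same-index) ⟩
    lookup S (index y∈S)    ≡⟨ sym (lookup-index y∈S) ⟩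
    _                       ∎
    where
    open ≡-Reasoning
    same-index : toℕ (index x∈S) ≡ toℕ (index y∈S)
    same-index = ⌊/2⌋-parity-injective _ _
      (trans (sym (toℕ-fromℕ< _)) (trans (cong toℕ same-pair) (toℕ-fromℕ< _))) same-parity

  outside-nonzero : ∀ {u} → u ∉ S → Fin.zero ≢ c u
  outside-nonzero u∉S 0≡cu = u∉S (class₀⊆S (∈-colourClass⁺ G c (sym 0≡cu)))

  recolour : Fin n → Fin χ′ ⊎ Fin ⌈ a /2⌉
  recolour u with u ∈? S
  ... | yes u∈S = inj₂ (pairColour u∈S)
  ... | no u∉S  = inj₁ (punchOut (outside-nonzero u∉S))

  recolour-proper : ∀ u v → Adj G u v → recolour u ≢ recolour v
  recolour-proper u v u~v with u ∈? S | v ∈? S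
  ... | yes u∈S | yes v∈S = λ _ → proj₂ indep u∈S v∈S u~v
  ... | yes _   | no _    = λ ()
  ... | no _    | yes _   = λ ()
  ... | no u∉S  | no v∉S  = λ e →
    proper u v u~v (punchOut-injective (outside-nonzero u∉S) (outside-nonzero v∉S) (inj₁-injective e))

  recolour-∈ : ∀ {s} → s ∈ S → ∃ λ t → recolour s ≡ inj₂ t
  recolour-∈ {s} s∈S with s ∈? S
  ... | yes s∈S′ = pairColour s∈S′ , refl
  ... | no s∉S   = ⊥-elim (s∉S s∈S)

  recolour-inj₂ : ∀ {x t} → recolour x ≡ inj₂ t → Σ (x ∈ S) λ x∈S → pairColour x∈S ≡ t
  recolour-inj₂ {x} with x ∈? S
  ... | yes x∈S = λ { refl → x∈S , refl }
  ... | no _    = λ ()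

  -- Three vertices of one pair class contain two of the same index parity.
  pairClass-two-equal : ∀ {s} → s ∈ S → ∀ {x y z} →
    recolour x ≡ recolour s → recolour y ≡ recolour s → recolour z ≡ recolour s →
    x ≡ y ⊎ x ≡ z ⊎ y ≡ z
  pairClass-two-equal s∈S ex ey ez with recolour-∈ s∈S
  ... | t , es with recolour-inj₂ (trans ex es) | recolour-inj₂ (trans ey es) | recolour-inj₂ (trans ez es)
  ... | x∈S , x↦t | y∈S , y↦t | z∈S , z↦t
    with parity-pigeonhole (parity (toℕ (index x∈S))) (parity (toℕ (index y∈S))) (parity (toℕ (index z∈S)))
  ... | inj₁ p≡        = inj₁ (pairColour-parity-injective x∈S y∈S (trans x↦t (sym y↦t)) p≡)
  ... | inj₂ (inj₁ p≡) = inj₂ (inj₁ (pairColour-parity-injective x∈S z∈S (trans x↦t (sym z↦t)) p≡))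
  ... | inj₂ (inj₂ p≡) = inj₂ (inj₂ (pairColour-parity-injective y∈S z∈S (trans y↦t (sym z↦t)) p≡))

  join-injective : ∀ {p q : Fin χ′ ⊎ Fin ⌈ a /2⌉} → join χ′ _ p ≡ join χ′ _ q → p ≡ q
  join-injective {p} {q} e =
    trans (sym (splitAt-join χ′ _ p)) (trans (cong (splitAt χ′) e) (splitAt-join χ′ _ q))

  mdColouring : ∃ λ k → k ≤ χ′ + ⌈ a /2⌉ × Σ (Fin n → Fin k) (IsMDColoring G)
  mdColouring =
    let k , k≤ , g , onto , ker = dropUnusedColours (χ′ + ⌈ a /2⌉) (λ u → join χ′ _ (recolour u))
        same : ∀ {u v} → g u ≡ g v → recolour u ≡ recolour v
        same {u} {v} e = join-injective (ker u v e)
    in k , k≤ , g , isMDColoring-fromSmallClasses G g S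
         (λ u v u~v e → recolour-proper u v u~v (same e)) onto dom
         (λ {s} s∈S → classSize≤2 G g (g s) λ ex ey ez → pairClass-two-equal s∈S (same ex) (same ey) (same ez))

mdChromatic-upper-bound : ∀ {n} (G : Graph (suc n)) χ a m → IsChromaticNumber G χ → IsIndependenceNumber G a →
  IsMDChromaticNumber G m → m + 1 ≤ χ + ⌈ a /2⌉
mdChromatic-upper-bound G zero a m ((c , _) , _) _ _ with c Fin.zero
... | ()
mdChromatic-upper-bound G (suc χ′) a m ((c , proper) , _) (_ , bound) (_ , minimal)
  with extendToDominating G bound a (colourClass G c Fin.zero) (colourClass-independent G proper Fin.zero)
         (m≤n+m a _)
... | S , indep , dom , class₀⊆S with PairColouring.mdColouring G proper indep dom (bound S indep) class₀⊆S
... | k , k≤ , g , md = subst (_≤ suc (χ′ + ⌈ a /2⌉)) (+-comm 1 m) (s≤s (≤-trans (minimal k g md) k≤))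

K₁ : Graph 1
K₁ = record { adj = λ _ _ → false ; sym = λ _ _ → refl ; irref = λ _ → refl }

atLeastOneColour : ∀ {n k} → (Fin (suc n) → Fin k) → 1 ≤ k
atLeastOneColour {k = zero} c with c Fin.zero
... | ()
atLeastOneColour {k = suc k} _ = s≤s z≤n

unique-Fin1-length≤1 : (xs : List (Fin 1)) → Unique xs → length xs ≤ 1
unique-Fin1-length≤1 [] _ = z≤n
unique-Fin1-length≤1 (_ ∷ []) _ = s≤s z≤n
unique-Fin1-length≤1 (Fin.zero ∷ Fin.zero ∷ _) ((0≢0 All.∷ _) ∷ _) = ⊥-elim (0≢0 refl)

K₁-connected : Connected K₁
K₁-connected Fin.zero Fin.zero = here

K₁-colouring : Fin 1 → Fin 1
K₁-colouring _ = Fin.zero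

K₁-chromaticNumber : IsChromaticNumber K₁ 1
K₁-chromaticNumber = (K₁-colouring , λ _ _ ()) , λ _ c _ → atLeastOneColour c

K₁-independenceNumber : IsIndependenceNumber K₁ 1
K₁-independenceNumber =
  (Fin.zero ∷ [] , ((All.[] ∷ []) , λ _ _ ()) , refl) , λ S indep → unique-Fin1-length≤1 S (proj₁ indep)

K₁-mdChromaticNumber : IsMDChromaticNumber K₁ 1
K₁-mdChromaticNumber =
  (K₁-colouring , (λ _ _ ()) , (λ { Fin.zero → Fin.zero , refl }) , λ { Fin.zero → Fin.zero , s≤s z≤n }) ,
  λ _ c _ → atLeastOneColour c

K₁-attains-bound : Σ ℕ λ n → Σ (Graph (suc n)) λ G → Connected G × ∃ λ χ → ∃ λ a → ∃ λ m →
  IsChromaticNumber G χ × IsIndependenceNumber G a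
  × IsMDChromaticNumber G m × m + 1 ≡ χ + ⌈ a /2⌉
K₁-attains-bound = 0 , K₁ , K₁-connected , 1 , 1 , 1 ,
  K₁-chromaticNumber , K₁-independenceNumber , K₁-mdChromaticNumber , refl

theorem2p1 :
    ((n : ℕ) (G : Graph (suc n)) → Connected G →
      ∀ χ a m → IsChromaticNumber G χ → IsIndependenceNumber G a →
      IsMDChromaticNumber G m → m + 1 ≤ χ + ⌈ a /2⌉)
    × (Σ ℕ λ n → Σ (Graph (suc n)) λ G → Connected G × ∃ λ χ → ∃ λ a → ∃ λ m →
        IsChromaticNumber G χ × IsIndependenceNumber G a
        × IsMDChromaticNumber G m × m + 1 ≡ χ + ⌈ a /2⌉)
-- The bound does not need connectivity.
theorem2p1 = (λ n G _ → mdChromatic-upper-bound G) , K₁-attains-bound
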